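{- Let $p>5$ be a prime. Then \[ \sum_{k=1}^{p-1}k^5H_k^2\equiv -\frac{77}{1200}p-\frac{1}{30}\pmod{p^2}. \]
   Context: $H_n=\sum_{i=1}^n 1/i$ are the harmonic numbers. For rationals $a,b$ whose denominators are coprime to $p$, $a\equiv b\pmod{p^2}$ means that $a-b$, written in lowest terms, has numerator divisible by $p^2$. -}

module Defs where

open import Data.Nat using (ℕ; zero; suc; _^_)
open import Data.Integer using (ℤ; +_)
open import Data.Integer.Divisibility using () renaming (_∣_ to _∣ℤ_)
open import Data.Rational using (ℚ; ↥_; _+_; _-_; _*_; 1/_; _/_; 0ℚ)

ℕ→ℚ : ℕ → ℚ
ℕ→ℚ n = (+ n) / 1

H : ℕ → ℚ
H zero = 0ℚ
H (suc n) = H n + ((+ 1) / suc n)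

S : ℕ → ℚ
S zero = 0ℚ
S (suc n) = S n + (ℕ→ℚ (suc n ^ 5) * (H (suc n) * H (suc n)))

-- a ≡ b (mod m): the numerator of a - b in lowest terms (ℚ is always normalised)
-- is divisible by m
_≡_[modℚ_] : ℚ → ℚ → ℕ → Set
a ≡ b [modℚ m ] = (+ m) ∣ℤ (↥ (a - b))

-- Write S n = Σ_{k=1}^{n} k⁵ H_k², and work throughout in ℚ.
--  1. Closed form.  21600·S n = A(n)·H_n² + B(n)·H_n + C(n) for explicit integer
--     polynomials A, B, C.  By induction on n; the inductive step is a polynomial
--     identity once the relation (n+1)·(1/(n+1)) = 1 is taken into account.
--  2. Pairing.  Pairing i with N − i gives 2·H_{N−1} = N·T_N, where
--     T_N = Σ_{i=1}^{N−1} 1/(i(N−i)); for N = p prime, T_p is p-integral.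
--  3. Reduction.  Substituting 2·H_{p−1} = p·T_p into the closed form at n = p − 1,
--     86400·(S (p−1) − rhs p) = p²·Y(p, T_p) for an integer polynomial Y.
--  4. Conclusion.  p-integral rationals (denominator prime to p) are closed under
--     + and *, so Y(p, T_p) is p-integral; as p ∤ 86400, p² divides the numerator
--     of S (p−1) − rhs p.
-- Pure ring normalisations (in ℕ, ℤ and ℚ) are discharged by the ring solvers.
module Submission where

open import Data.Nat as ℕ using (ℕ; zero; suc; _∸_; _^_; _>_)
import Data.Nat.Properties as ℕP
import Data.Nat.Solver as ℕSolver
open import Data.Nat.Divisibility using (_∣_; _∤_; divides; >⇒∤; ∣-trans; m∣m*n; *-cancelˡ-∣; ∣1⇒≡1)
open import Data.Nat.Primality using (Prime; euclidsLemma; ¬prime[1]; prime⇒nonZero)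
open import Data.Integer as ℤ using (ℤ; +_; -_)
import Data.Integer.Properties as ℤP
import Data.Integer.Solver as ℤSolver
open import Data.Rational using (ℚ; mkℚ; ↥_; ↧_; _/_; _+_; _-_; _*_; 0ℚ; 1ℚ; toℚᵘ; +-*-rawSemiring)
open import Data.Rational.Properties using (*-comm; *-identityʳ; toℚᵘ-injective; toℚᵘ-fromℚᵘ; toℚᵘ-homo-+; toℚᵘ-homo-*)
import Data.Rational.Unnormalised as ℚᵘ
import Data.Rational.Unnormalised.Properties as ℚᵘP
import Data.Rational.Solver as ℚSolver
open import Algebra.Definitions.RawSemiring +-*-rawSemiring using () renaming (_^_ to _^ℚ_)
open import Data.List using (List; []; _∷_)
open import Data.Sum using (inj₁; inj₂)
open import Relation.Nullary using (contradiction)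
open import Relation.Binary.PropositionalEquality
open import Defs

module ℕS = ℕSolver.+-*-Solver
module ℤS = ℤSolver.+-*-Solver
module ℚS = ℚSolver.+-*-Solver

ℤ→ℚ : ℤ → ℚ
ℤ→ℚ i = i / 1

toℚᵘ-ℤ→ℚ : ∀ i → toℚᵘ (ℤ→ℚ i) ℚᵘ.≃ ℚᵘ.mkℚᵘ i 0
toℚᵘ-ℤ→ℚ i = toℚᵘ-fromℚᵘ (ℚᵘ.mkℚᵘ i 0)

ℤ→ℚ-+ : ∀ i j → ℤ→ℚ (i ℤ.+ j) ≡ ℤ→ℚ i + ℤ→ℚ j
ℤ→ℚ-+ i j = toℚᵘ-injective (begin
  toℚᵘ (ℤ→ℚ (i ℤ.+ j))                ≈⟨ toℚᵘ-ℤ→ℚ (i ℤ.+ j) ⟩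
  ℚᵘ.mkℚᵘ (i ℤ.+ j) 0                 ≈⟨ ℚᵘ.*≡* (solve 2 (λ a b → (a :+ b) :* con (+ 1) := (a :* con (+ 1) :+ b :* con (+ 1)) :* con (+ 1)) refl i j) ⟩
  ℚᵘ.mkℚᵘ i 0 ℚᵘ.+ ℚᵘ.mkℚᵘ j 0        ≈⟨ ℚᵘP.+-cong (ℚᵘP.≃-sym (toℚᵘ-ℤ→ℚ i)) (ℚᵘP.≃-sym (toℚᵘ-ℤ→ℚ j)) ⟩
  toℚᵘ (ℤ→ℚ i) ℚᵘ.+ toℚᵘ (ℤ→ℚ j)      ≈⟨ ℚᵘP.≃-sym (toℚᵘ-homo-+ (ℤ→ℚ i) (ℤ→ℚ j)) ⟩
  toℚᵘ (ℤ→ℚ i + ℤ→ℚ j)                ∎)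
  where open ℚᵘP.≃-Reasoning; open ℤS

ℤ→ℚ-* : ∀ i j → ℤ→ℚ (i ℤ.* j) ≡ ℤ→ℚ i * ℤ→ℚ j
ℤ→ℚ-* i j = toℚᵘ-injective (begin
  toℚᵘ (ℤ→ℚ (i ℤ.* j))                ≈⟨ toℚᵘ-ℤ→ℚ (i ℤ.* j) ⟩
  ℚᵘ.mkℚᵘ (i ℤ.* j) 0                 ≈⟨ ℚᵘ.*≡* refl ⟩
  ℚᵘ.mkℚᵘ i 0 ℚᵘ.* ℚᵘ.mkℚᵘ j 0        ≈⟨ ℚᵘP.*-cong (ℚᵘP.≃-sym (toℚᵘ-ℤ→ℚ i)) (ℚᵘP.≃-sym (toℚᵘ-ℤ→ℚ j)) ⟩
  toℚᵘ (ℤ→ℚ i) ℚᵘ.* toℚᵘ (ℤ→ℚ j)      ≈⟨ ℚᵘP.≃-sym (toℚᵘ-homo-* (ℤ→ℚ i) (ℤ→ℚ j)) ⟩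
  toℚᵘ (ℤ→ℚ i * ℤ→ℚ j)                ∎)
  where open ℚᵘP.≃-Reasoning

ℕ→ℚ-+ : ∀ m n → ℕ→ℚ (m ℕ.+ n) ≡ ℕ→ℚ m + ℕ→ℚ n
ℕ→ℚ-+ m n = trans (cong ℤ→ℚ (ℤP.pos-+ m n)) (ℤ→ℚ-+ (+ m) (+ n))

ℕ→ℚ-* : ∀ m n → ℕ→ℚ (m ℕ.* n) ≡ ℕ→ℚ m * ℕ→ℚ n
ℕ→ℚ-* m n = trans (cong ℤ→ℚ (ℤP.pos-* m n)) (ℤ→ℚ-* (+ m) (+ n))

ℕ→ℚ-suc : ∀ n → ℕ→ℚ (suc n) ≡ 1ℚ + ℕ→ℚ n
ℕ→ℚ-suc = ℕ→ℚ-+ 1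

-- _^ℚ_ is the power used by the ring solver's _:^_, so powers can be normalised.
ℕ→ℚ-^ : ∀ m k → ℕ→ℚ (m ^ k) ≡ ℕ→ℚ m ^ℚ k
ℕ→ℚ-^ m zero    = refl
ℕ→ℚ-^ m (suc k) = trans (ℕ→ℚ-* m (m ^ k)) (cong (ℕ→ℚ m *_) (ℕ→ℚ-^ m k))

-- recip k = 1/k (and 0 at k = 0); note H (suc n) = H n + recip (suc n) by definition.
recip : ℕ → ℚ
recip zero    = 0ℚ
recip (suc n) = (+ 1) / suc n

recip-inverse : ∀ n → ℕ→ℚ (suc n) * recip (suc n) ≡ 1ℚ
recip-inverse n = toℚᵘ-injective (begin
  toℚᵘ (ℕ→ℚ (suc n) * recip (suc n))             ≈⟨ toℚᵘ-homo-* (ℕ→ℚ (suc n)) (recip (suc n)) ⟩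
  toℚᵘ (ℕ→ℚ (suc n)) ℚᵘ.* toℚᵘ (recip (suc n))   ≈⟨ ℚᵘP.*-cong (toℚᵘ-ℤ→ℚ (+ suc n)) (toℚᵘ-fromℚᵘ (ℚᵘ.mkℚᵘ (+ 1) n)) ⟩
  ℚᵘ.mkℚᵘ (+ suc n) 0 ℚᵘ.* ℚᵘ.mkℚᵘ (+ 1) n       ≈⟨ ℚᵘ.*≡* (ℤS.solve 1 (λ a → (a ℤS.:* ℤS.con (+ 1)) ℤS.:* ℤS.con (+ 1) ℤS.:= ℤS.con (+ 1) ℤS.:* (ℤS.con (+ 1) ℤS.:* a)) refl (+ suc n)) ⟩
  toℚᵘ 1ℚ                                        ∎)
  where open ℚᵘP.≃-Reasoning

-- Integer polynomials in one and two variables, as coefficient lists (constant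
-- term first), evaluated by Horner's rule; Horner/Horner₂ build the same
-- expressions as solver polynomials, so identities between them are checkable.

horner : List ℤ → ℚ → ℚ
horner []       x = 0ℚ
horner (c ∷ cs) x = ℤ→ℚ c + x * horner cs x

horner₂ : List (List ℤ) → ℚ → ℚ → ℚ
horner₂ []         x y = 0ℚ
horner₂ (cs ∷ css) x y = horner cs x + y * horner₂ css x y

Horner : ∀ {k} → List ℤ → ℚS.Polynomial k → ℚS.Polynomial k
Horner []       x = ℚS.con 0ℚ
Horner (c ∷ cs) x = ℚS.con (ℤ→ℚ c) ℚS.:+ x ℚS.:* Horner cs x

Horner₂ : ∀ {k} → List (List ℤ) → ℚS.Polynomial k → ℚS.Polynomial k → ℚS.Polynomial k
Horner₂ []         x y = ℚS.con 0ℚ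
Horner₂ (cs ∷ css) x y = Horner cs x ℚS.:+ y ℚS.:* Horner₂ css x y

Acs Bcs Ccs : List ℤ
Acs = + 0 ∷ + 0 ∷ - + 1800 ∷ + 0 ∷ + 9000 ∷ + 10800 ∷ + 3600 ∷ []
Bcs = + 0 ∷ + 1080 ∷ - + 2100 ∷ - + 1800 ∷ + 3300 ∷ + 720 ∷ - + 1200 ∷ []
Ccs = + 0 ∷ + 714 ∷ - + 775 ∷ - + 90 ∷ + 215 ∷ - + 264 ∷ + 200 ∷ []

closedFormCoeffs : List (List ℤ)
closedFormCoeffs = Ccs ∷ Bcs ∷ Acs ∷ []

closedForm : ℚ → ℚ → ℚ
closedForm = horner₂ closedFormCoeffs

-- The inductive step holds only modulo the relation (1+y)·v = 1; `correction`
-- is the cofactor exhibiting the difference as a multiple of (1+y)·v − 1.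
βcs γcs : List ℤ
βcs = - + 1800 ∷ + 0 ∷ + 9000 ∷ - + 10800 ∷ + 3600 ∷ []
γcs = - + 2520 ∷ - + 2100 ∷ + 16200 ∷ - + 18300 ∷ + 7920 ∷ - + 1200 ∷ []

correction : ℚ → ℚ → ℚ → ℚ
correction y h v =
  ℤ→ℚ (+ 2) * (1ℚ + y) * horner βcs (1ℚ + y) * h + horner βcs (1ℚ + y) * ((1ℚ + y) * v - 1ℚ) + horner γcs (1ℚ + y)

closedForm-step : ∀ y h v → (1ℚ + y) * v ≡ 1ℚ →
  closedForm y h + ℤ→ℚ (+ 21600) * (1ℚ + y) ^ℚ 5 * ((h + v) * (h + v)) ≡ closedForm (1ℚ + y) (h + v)
closedForm-step y h v inverse = begin
  F + Δ                               ≡⟨ solve 2 (λ x g → x := x :+ (con 1ℚ :- con 1ℚ) :* g) refl (F + Δ) G ⟩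
  (F + Δ) + (1ℚ - 1ℚ) * G             ≡⟨ cong (λ u → (F + Δ) + (u - 1ℚ) * G) (sym inverse) ⟩
  (F + Δ) + ((1ℚ + y) * v - 1ℚ) * G   ≡⟨ identity y h v ⟩
  closedForm (1ℚ + y) (h + v)         ∎
  where
  open ≡-Reasoning
  open ℚS
  F = closedForm y h
  Δ = ℤ→ℚ (+ 21600) * (1ℚ + y) ^ℚ 5 * ((h + v) * (h + v))
  G = correction y h v
  identity : ∀ y h v →
    (closedForm y h + ℤ→ℚ (+ 21600) * (1ℚ + y) ^ℚ 5 * ((h + v) * (h + v))) + ((1ℚ + y) * v - 1ℚ) * correction y h v
      ≡ closedForm (1ℚ + y) (h + v)
  identity = solve 3 (λ y h v → let m = con 1ℚ :+ y in
      (Horner₂ closedFormCoeffs y h :+ con (ℤ→ℚ (+ 21600)) :* m :^ 5 :* ((h :+ v) :* (h :+ v)))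
      :+ (m :* v :- con 1ℚ) :* (con (ℤ→ℚ (+ 2)) :* m :* Horner βcs m :* h :+ Horner βcs m :* (m :* v :- con 1ℚ) :+ Horner γcs m)
    := Horner₂ closedFormCoeffs m (h :+ v)) refl

S-closedForm : ∀ n → ℤ→ℚ (+ 21600) * S n ≡ closedForm (ℕ→ℚ n) (H n)
S-closedForm zero    = refl
S-closedForm (suc n) = begin
  κ * (S n + ℕ→ℚ (suc n ^ 5) * (H′ * H′))              ≡⟨ cong (λ c → κ * (S n + c * (H′ * H′))) fifth-power ⟩
  κ * (S n + (1ℚ + y) ^ℚ 5 * (H′ * H′))                ≡⟨ solve 3 (λ s c h → con κ :* (s :+ c :* h) := con κ :* s :+ con κ :* c :* h) refl (S n) ((1ℚ + y) ^ℚ 5) (H′ * H′) ⟩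
  κ * S n + κ * (1ℚ + y) ^ℚ 5 * (H′ * H′)              ≡⟨ cong (_+ κ * (1ℚ + y) ^ℚ 5 * (H′ * H′)) (S-closedForm n) ⟩
  closedForm y (H n) + κ * (1ℚ + y) ^ℚ 5 * (H′ * H′)   ≡⟨ closedForm-step y (H n) v inverse ⟩
  closedForm (1ℚ + y) H′                               ≡⟨ cong (λ x → closedForm x H′) (sym (ℕ→ℚ-suc n)) ⟩
  closedForm (ℕ→ℚ (suc n)) H′                          ∎
  where
  open ≡-Reasoning
  open ℚS
  κ = ℤ→ℚ (+ 21600)
  y = ℕ→ℚ n
  v = recip (suc n)
  H′ = H (suc n)
  fifth-power : ℕ→ℚ (suc n ^ 5) ≡ (1ℚ + y) ^ℚ 5
  fifth-power = trans (ℕ→ℚ-^ (suc n) 5) (cong (_^ℚ 5) (ℕ→ℚ-suc n))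
  inverse : (1ℚ + y) * v ≡ 1ℚ
  inverse = trans (cong (_* v) (sym (ℕ→ℚ-suc n))) (recip-inverse n)

T : ℕ → ℕ → ℚ
T N zero    = 0ℚ
T N (suc m) = T N m + recip (suc m) * recip (N ∸ suc m)

recip-sum : ∀ m j → recip (suc m) + recip (suc j) ≡ ℕ→ℚ (suc m ℕ.+ suc j) * (recip (suc m) * recip (suc j))
recip-sum m j = sym (begin
  ℕ→ℚ (suc m ℕ.+ suc j) * (a * b)  ≡⟨ cong (_* (a * b)) (ℕ→ℚ-+ (suc m) (suc j)) ⟩
  (A + B) * (a * b)                ≡⟨ solve 4 (λ A B a b → (A :+ B) :* (a :* b) := (A :* a) :* b :+ (B :* b) :* a) refl A B a b ⟩
  (A * a) * b + (B * b) * a        ≡⟨ cong₂ (λ u w → u * b + w * a) (recip-inverse m) (recip-inverse j) ⟩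
  1ℚ * b + 1ℚ * a                  ≡⟨ solve 2 (λ a b → con 1ℚ :* b :+ con 1ℚ :* a := a :+ b) refl a b ⟩
  a + b                            ∎)
  where
  open ≡-Reasoning
  open ℚS
  a = recip (suc m)
  b = recip (suc j)
  A = ℕ→ℚ (suc m)
  B = ℕ→ℚ (suc j)

complement-∸ : ∀ m j {n} → suc m ℕ.+ j ≡ n → n ∸ m ≡ suc j
complement-∸ m j refl = trans (cong (_∸ m) (sym (ℕP.+-suc m j))) (ℕP.m+n∸m≡n m (suc j))

-- For m + j = n:  H_m + H_n − H_j = (n+1)·T_{n+1}(m).  Moving one index from the
-- "j" side to the "m" side contributes 1/(m+1) + 1/(j+1) = (n+1)/((m+1)(j+1)).
harmonic-pairing : ∀ n m j → m ℕ.+ j ≡ n → H m + H n - H j ≡ ℕ→ℚ (suc n) * T (suc n) m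
harmonic-pairing n zero    j refl = solve 2 (λ h N → con 0ℚ :+ h :- h := N :* con 0ℚ) refl (H j) (ℕ→ℚ (suc j))
  where open ℚS
harmonic-pairing n (suc m) j eq = begin
  (H m + a) + H n - H j                              ≡⟨ solve 5 (λ hm a hn hj b → (hm :+ a) :+ hn :- hj := (hm :+ hn :- (hj :+ b)) :+ (a :+ b)) refl (H m) a (H n) (H j) b ⟩
  (H m + H n - H (suc j)) + (a + b)                  ≡⟨ cong₂ _+_ (harmonic-pairing n m (suc j) m+sj≡n) (recip-sum m j) ⟩
  N * T (suc n) m + ℕ→ℚ (suc m ℕ.+ suc j) * (a * b)  ≡⟨ cong (λ k → N * T (suc n) m + ℕ→ℚ k * (a * b)) (cong suc m+sj≡n) ⟩
  N * T (suc n) m + N * (a * b)                      ≡⟨ solve 4 (λ N t a b → N :* t :+ N :* (a :* b) := N :* (t :+ a :* b)) refl N (T (suc n) m) a b ⟩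
  N * (T (suc n) m + a * b)                          ≡⟨ cong (λ k → N * (T (suc n) m + a * recip k)) (sym (complement-∸ m j eq)) ⟩
  N * T (suc n) (suc m)                              ∎
  where
  open ≡-Reasoning
  open ℚS
  a = recip (suc m)
  b = recip (suc j)
  N = ℕ→ℚ (suc n)
  m+sj≡n : m ℕ.+ suc j ≡ n
  m+sj≡n = trans (ℕP.+-suc m j) eq

twice-harmonic : ∀ n → H n + H n ≡ ℕ→ℚ (suc n) * T (suc n) n
twice-harmonic n =
  trans (ℚS.solve 1 (λ h → h ℚS.:+ h ℚS.:= h ℚS.:+ h ℚS.:- ℚS.con 0ℚ) refl (H n))
        (harmonic-pairing n n 0 (ℕP.+-identityʳ n))

∤-1 : ∀ {p} → Prime p → p ∤ 1
∤-1 p-prime p∣1 = ¬prime[1] (subst Prime (∣1⇒≡1 p∣1) p-prime)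

∤-* : ∀ {p a b} → Prime p → p ∤ a → p ∤ b → p ∤ a ℕ.* b
∤-* {a = a} {b} p-prime p∤a p∤b p∣ab with euclidsLemma a b p-prime p∣ab
... | inj₁ p∣a = p∤a p∣a
... | inj₂ p∣b = p∤b p∣b

∤-^ : ∀ {p a} → Prime p → p ∤ a → ∀ k → p ∤ a ^ k
∤-^ p-prime p∤a zero    = ∤-1 p-prime
∤-^ p-prime p∤a (suc k) = ∤-* p-prime p∤a (∤-^ p-prime p∤a k)

-- 86400 = 2⁷·3³·5², so no prime p > 5 divides it.
∤-86400 : ∀ {p} → Prime p → p > 5 → p ∤ 86400
∤-86400 {p} p-prime p>5 =
  ∤-* p-prime (∤-* p-prime (∤-^ p-prime (small 2 (ℕP.m≤m+n 2 3)) 7) (∤-^ p-prime (small 3 (ℕP.m≤m+n 3 2)) 3))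
    (∤-^ p-prime (small 5 ℕP.≤-refl) 2)
  where
  small : ∀ k → .{{ℕ.NonZero k}} → k ℕ.≤ 5 → p ∤ k
  small k k≤5 = >⇒∤ (ℕP.≤-<-trans k≤5 p>5)

square-∣-cancel : ∀ {p x m} → Prime p → p ∤ m → p ℕ.* p ∣ x ℕ.* m → p ℕ.* p ∣ x
square-∣-cancel {p} {x} {m} p-prime p∤m p²∣xm with euclidsLemma x m p-prime (∣-trans (m∣m*n p) p²∣xm)
... | inj₂ p∣m = contradiction p∣m p∤m
... | inj₁ (divides q refl) with euclidsLemma q m p-prime p∣qm
  where
  p∣qm : p ∣ q ℕ.* m
  p∣qm = *-cancelˡ-∣ p {{prime⇒nonZero p-prime}}
           (subst (p ℕ.* p ∣_) (ℕS.solve 3 (λ q p m → q ℕS.:* p ℕS.:* m ℕS.:= p ℕS.:* (q ℕS.:* m)) refl q p m) p²∣xm)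
... | inj₂ p∣m = contradiction p∣m p∤m
... | inj₁ (divides r refl) = divides r (ℕP.*-assoc r p p)

record Integral (p : ℕ) (x : ℚ) : Set where
  constructor integral
  field
    denominator   : ℕ
    numerator     : ℤ
    p∤denominator : p ∤ denominator
    cleared       : x * ℕ→ℚ denominator ≡ ℤ→ℚ numerator

module _ {p : ℕ} (p-prime : Prime p) where

  Integral-ℤ : ∀ a → Integral p (ℤ→ℚ a)
  Integral-ℤ a = integral 1 a (∤-1 p-prime) (*-identityʳ (ℤ→ℚ a))

  Integral-+ : ∀ {x y} → Integral p x → Integral p y → Integral p (x + y)
  Integral-+ {x} {y} (integral d₁ a₁ p∤d₁ e₁) (integral d₂ a₂ p∤d₂ e₂) =
    integral (d₁ ℕ.* d₂) (a₁ ℤ.* + d₂ ℤ.+ a₂ ℤ.* + d₁) (∤-* p-prime p∤d₁ p∤d₂) (begin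
      (x + y) * ℕ→ℚ (d₁ ℕ.* d₂)              ≡⟨ cong ((x + y) *_) (ℕ→ℚ-* d₁ d₂) ⟩
      (x + y) * (D₁ * D₂)                    ≡⟨ solve 4 (λ x y D₁ D₂ → (x :+ y) :* (D₁ :* D₂) := (x :* D₁) :* D₂ :+ (y :* D₂) :* D₁) refl x y D₁ D₂ ⟩
      (x * D₁) * D₂ + (y * D₂) * D₁          ≡⟨ cong₂ (λ u w → u * D₂ + w * D₁) e₁ e₂ ⟩
      ℤ→ℚ a₁ * D₂ + ℤ→ℚ a₂ * D₁              ≡⟨ sym (cong₂ _+_ (ℤ→ℚ-* a₁ (+ d₂)) (ℤ→ℚ-* a₂ (+ d₁))) ⟩
      ℤ→ℚ (a₁ ℤ.* + d₂) + ℤ→ℚ (a₂ ℤ.* + d₁)  ≡⟨ sym (ℤ→ℚ-+ (a₁ ℤ.* + d₂) (a₂ ℤ.* + d₁)) ⟩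
      ℤ→ℚ (a₁ ℤ.* + d₂ ℤ.+ a₂ ℤ.* + d₁)      ∎)
    where
    open ≡-Reasoning
    open ℚS
    D₁ = ℕ→ℚ d₁
    D₂ = ℕ→ℚ d₂

  Integral-* : ∀ {x y} → Integral p x → Integral p y → Integral p (x * y)
  Integral-* {x} {y} (integral d₁ a₁ p∤d₁ e₁) (integral d₂ a₂ p∤d₂ e₂) =
    integral (d₁ ℕ.* d₂) (a₁ ℤ.* a₂) (∤-* p-prime p∤d₁ p∤d₂) (begin
      (x * y) * ℕ→ℚ (d₁ ℕ.* d₂)  ≡⟨ cong ((x * y) *_) (ℕ→ℚ-* d₁ d₂) ⟩
      (x * y) * (D₁ * D₂)        ≡⟨ solve 4 (λ x y D₁ D₂ → (x :* y) :* (D₁ :* D₂) := (x :* D₁) :* (y :* D₂)) refl x y D₁ D₂ ⟩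
      (x * D₁) * (y * D₂)        ≡⟨ cong₂ _*_ e₁ e₂ ⟩
      ℤ→ℚ a₁ * ℤ→ℚ a₂            ≡⟨ sym (ℤ→ℚ-* a₁ a₂) ⟩
      ℤ→ℚ (a₁ ℤ.* a₂)            ∎)
    where
    open ≡-Reasoning
    open ℚS
    D₁ = ℕ→ℚ d₁
    D₂ = ℕ→ℚ d₂

  Integral-recip : ∀ k → suc k ℕ.< p → Integral p (recip (suc k))
  Integral-recip k k<p = integral (suc k) (+ 1) (>⇒∤ k<p)
    (trans (*-comm (recip (suc k)) (ℕ→ℚ (suc k))) (recip-inverse k))

  Integral-horner : ∀ cs {x} → Integral p x → Integral p (horner cs x)
  Integral-horner []       x-int = Integral-ℤ (+ 0)
  Integral-horner (c ∷ cs) x-int = Integral-+ (Integral-ℤ c) (Integral-* x-int (Integral-horner cs x-int))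

  Integral-horner₂ : ∀ css {x y} → Integral p x → Integral p y → Integral p (horner₂ css x y)
  Integral-horner₂ []         x-int y-int = Integral-ℤ (+ 0)
  Integral-horner₂ (cs ∷ css) x-int y-int =
    Integral-+ (Integral-horner cs x-int) (Integral-* y-int (Integral-horner₂ css x-int y-int))

-- Every term 1/(i(p − i)) of T_p has both factors below p, so T_p is p-integral.
Integral-T : ∀ {n} → Prime (suc n) → ∀ m j → m ℕ.+ j ≡ n → Integral (suc n) (T (suc n) m)
Integral-T p-prime zero    j eq = Integral-ℤ p-prime (+ 0)
Integral-T {n} p-prime (suc m) j eq =
  Integral-+ p-prime (Integral-T p-prime m (suc j) (trans (ℕP.+-suc m j) eq))
    (Integral-* p-prime (Integral-recip p-prime m sm<p)
      (subst (λ k → Integral (suc n) (recip k)) (sym (complement-∸ m j eq)) (Integral-recip p-prime j sj<p)))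
  where
  sm<p = ℕ.s≤s (subst (suc m ℕ.≤_) eq (ℕP.m≤m+n (suc m) j))
  sj<p = ℕ.s≤s (subst (suc j ℕ.≤_) eq (ℕ.s≤s (ℕP.m≤n+m j m)))

cleared-in-ℚᵘ : ∀ z M c → z * ℕ→ℚ M ≡ ℤ→ℚ c → toℚᵘ z ℚᵘ.* ℚᵘ.mkℚᵘ (+ M) 0 ℚᵘ.≃ ℚᵘ.mkℚᵘ c 0
cleared-in-ℚᵘ z M c e = begin
  toℚᵘ z ℚᵘ.* ℚᵘ.mkℚᵘ (+ M) 0     ≈⟨ ℚᵘP.*-congˡ {toℚᵘ z} (ℚᵘP.≃-sym (toℚᵘ-ℤ→ℚ (+ M))) ⟩
  toℚᵘ z ℚᵘ.* toℚᵘ (ℕ→ℚ M)        ≈⟨ ℚᵘP.≃-sym (toℚᵘ-homo-* z (ℕ→ℚ M)) ⟩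
  toℚᵘ (z * ℕ→ℚ M)                ≡⟨ cong toℚᵘ e ⟩
  toℚᵘ (ℤ→ℚ c)                    ≈⟨ toℚᵘ-ℤ→ℚ c ⟩
  ℚᵘ.mkℚᵘ c 0                     ∎
  where open ℚᵘP.≃-Reasoning

clear-denominator : ∀ z M c → z * ℕ→ℚ M ≡ ℤ→ℚ c → ↥ z ℤ.* + M ≡ c ℤ.* ↧ z
clear-denominator z@(mkℚ a b _) M c e = begin
  a ℤ.* + M                  ≡⟨ sym (ℤP.*-identityʳ (a ℤ.* + M)) ⟩
  (a ℤ.* + M) ℤ.* + 1        ≡⟨ ℚᵘP.drop-*≡* (cleared-in-ℚᵘ z M c e) ⟩
  c ℤ.* + (suc b ℕ.* 1)      ≡⟨ cong (λ d → c ℤ.* + d) (ℕP.*-identityʳ (suc b)) ⟩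
  c ℤ.* + suc b              ∎
  where open ≡-Reasoning

-- Step 4 in general form: if K·z = p²·w with p ∤ K and w p-integral, then p²
-- divides the numerator of z.  (Clear w's denominator d: ↥z·K·d = p²·a·↧z.)
numerator-divisible : ∀ {p K} z {w} → Prime p → p ∤ K → Integral p w →
  ℕ→ℚ K * z ≡ ℕ→ℚ (p ℕ.* p) * w → p ℕ.* p ∣ ℤ.∣ ↥ z ∣
numerator-divisible {p} {K} z {w} p-prime p∤K (integral d a p∤d wd≡a) Kz≡p²w =
  square-∣-cancel p-prime (∤-* p-prime p∤K p∤d)
    (subst (p ℕ.* p ∣_) (sym numerators) (∣-trans (m∣m*n ℤ.∣ a ∣) (m∣m*n ℤ.∣ ↧ z ∣)))
  where
  open ≡-Reasoning
  open ℚS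
  z·Kd : z * ℕ→ℚ (K ℕ.* d) ≡ ℤ→ℚ (+ (p ℕ.* p) ℤ.* a)
  z·Kd = begin
    z * ℕ→ℚ (K ℕ.* d)               ≡⟨ cong (z *_) (ℕ→ℚ-* K d) ⟩
    z * (ℕ→ℚ K * ℕ→ℚ d)             ≡⟨ solve 3 (λ z k d → z :* (k :* d) := (k :* z) :* d) refl z (ℕ→ℚ K) (ℕ→ℚ d) ⟩
    (ℕ→ℚ K * z) * ℕ→ℚ d             ≡⟨ cong (_* ℕ→ℚ d) Kz≡p²w ⟩
    (ℕ→ℚ (p ℕ.* p) * w) * ℕ→ℚ d     ≡⟨ solve 3 (λ q w d → (q :* w) :* d := q :* (w :* d)) refl (ℕ→ℚ (p ℕ.* p)) w (ℕ→ℚ d) ⟩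
    ℕ→ℚ (p ℕ.* p) * (w * ℕ→ℚ d)     ≡⟨ cong (ℕ→ℚ (p ℕ.* p) *_) wd≡a ⟩
    ℕ→ℚ (p ℕ.* p) * ℤ→ℚ a           ≡⟨ sym (ℤ→ℚ-* (+ (p ℕ.* p)) a) ⟩
    ℤ→ℚ (+ (p ℕ.* p) ℤ.* a)         ∎
  numerators : ℤ.∣ ↥ z ∣ ℕ.* (K ℕ.* d) ≡ (p ℕ.* p ℕ.* ℤ.∣ a ∣) ℕ.* ℤ.∣ ↧ z ∣
  numerators = begin
    ℤ.∣ ↥ z ∣ ℕ.* (K ℕ.* d)                  ≡⟨ sym (ℤP.abs-* (↥ z) (+ (K ℕ.* d))) ⟩
    ℤ.∣ ↥ z ℤ.* + (K ℕ.* d) ∣                ≡⟨ cong ℤ.∣_∣ (clear-denominator z (K ℕ.* d) (+ (p ℕ.* p) ℤ.* a) z·Kd) ⟩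
    ℤ.∣ (+ (p ℕ.* p) ℤ.* a) ℤ.* ↧ z ∣        ≡⟨ ℤP.abs-* (+ (p ℕ.* p) ℤ.* a) (↧ z) ⟩
    ℤ.∣ + (p ℕ.* p) ℤ.* a ∣ ℕ.* ℤ.∣ ↧ z ∣    ≡⟨ cong (ℕ._* ℤ.∣ ↧ z ∣) (ℤP.abs-* (+ (p ℕ.* p)) a) ⟩
    (p ℕ.* p ℕ.* ℤ.∣ a ∣) ℕ.* ℤ.∣ ↧ z ∣      ∎

rhs : ℚ → ℚ
rhs x = ((- (+ 77)) / 1200) * x - ((+ 1) / 30)

reducedCoeffs : List (List ℤ)
reducedCoeffs =
  (+ 25700 ∷ - + 30360 ∷ + 18140 ∷ - + 5856 ∷ + 800 ∷ []) ∷
  (- + 5040 ∷ - + 4200 ∷ + 32400 ∷ - + 36600 ∷ + 15840 ∷ - + 2400 ∷ []) ∷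
  (+ 0 ∷ + 0 ∷ - + 1800 ∷ + 0 ∷ + 9000 ∷ - + 10800 ∷ + 3600 ∷ []) ∷ []

reduced : ℚ → ℚ → ℚ
reduced = horner₂ reducedCoeffs

-- If 2h = (1+y)·t, then 4·closedForm y h − 86400·rhs (1+y) = (1+y)²·reduced (1+y) t.
-- The closed form is rewritten in terms of 2h (`doubled`), which is then replaced.
reduction : ∀ y h t → h + h ≡ (1ℚ + y) * t →
  ℤ→ℚ (+ 4) * closedForm y h - ℤ→ℚ (+ 86400) * rhs (1ℚ + y) ≡ ((1ℚ + y) * (1ℚ + y)) * reduced (1ℚ + y) t
reduction y h t 2h≡Pt = begin
  ℤ→ℚ (+ 4) * closedForm y h - ℤ→ℚ (+ 86400) * rhs P
    ≡⟨ solve 2 (λ y h → con (ℤ→ℚ (+ 4)) :* Horner₂ closedFormCoeffs y h :- con (ℤ→ℚ (+ 86400)) :* Rhs (con 1ℚ :+ y)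
                        := Doubled y (h :+ h)) refl y h ⟩
  doubled (h + h)          ≡⟨ cong doubled 2h≡Pt ⟩
  doubled (P * t)
    ≡⟨ solve 2 (λ y t → let P = con 1ℚ :+ y in Doubled y (P :* t) := (P :* P) :* Horner₂ reducedCoeffs P t) refl y t ⟩
  (P * P) * reduced P t    ∎
  where
  open ≡-Reasoning
  open ℚS
  P = 1ℚ + y
  doubled : ℚ → ℚ
  doubled u = horner Acs y * (u * u) + ℤ→ℚ (+ 2) * horner Bcs y * u + ℤ→ℚ (+ 4) * horner Ccs y - ℤ→ℚ (+ 86400) * rhs P
  Rhs : Polynomial 2 → Polynomial 2
  Rhs x = con ((- (+ 77)) / 1200) :* x :- con ((+ 1) / 30)
  Doubled : Polynomial 2 → Polynomial 2 → Polynomial 2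
  Doubled y u = Horner Acs y :* (u :* u) :+ con (ℤ→ℚ (+ 2)) :* Horner Bcs y :* u :+ con (ℤ→ℚ (+ 4)) :* Horner Ccs y
                :- con (ℤ→ℚ (+ 86400)) :* Rhs (con 1ℚ :+ y)

shifted-sum-identity : ∀ n →
  ℕ→ℚ 86400 * (S n - rhs (ℕ→ℚ (suc n))) ≡ ℕ→ℚ (suc n ℕ.* suc n) * reduced (ℕ→ℚ (suc n)) (T (suc n) n)
shifted-sum-identity n = begin
  K * (S n - rhs N)                              ≡⟨ cong (λ x → K * (S n - rhs x)) (ℕ→ℚ-suc n) ⟩
  K * (S n - rhs P)                              ≡⟨ solve 2 (λ s r → con K :* (s :- r) := con (ℤ→ℚ (+ 4)) :* (con (ℤ→ℚ (+ 21600)) :* s) :- con K :* r) refl (S n) (rhs P) ⟩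
  ℤ→ℚ (+ 4) * (ℤ→ℚ (+ 21600) * S n) - K * rhs P ≡⟨ cong (λ x → ℤ→ℚ (+ 4) * x - K * rhs P) (S-closedForm n) ⟩
  ℤ→ℚ (+ 4) * closedForm y (H n) - K * rhs P     ≡⟨ reduction y (H n) t (trans (twice-harmonic n) (cong (_* t) (ℕ→ℚ-suc n))) ⟩
  (P * P) * reduced P t                          ≡⟨ cong (λ x → (x * x) * reduced x t) (sym (ℕ→ℚ-suc n)) ⟩
  (N * N) * reduced N t                          ≡⟨ cong (_* reduced N t) (sym (ℕ→ℚ-* (suc n) (suc n))) ⟩
  ℕ→ℚ (suc n ℕ.* suc n) * reduced N t            ∎
  where
  open ≡-Reasoning
  open ℚS
  K = ℕ→ℚ 86400
  y = ℕ→ℚ n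
  N = ℕ→ℚ (suc n)
  P = 1ℚ + y
  t = T (suc n) n

corollary3p2 : (p : ℕ) → Prime p → p > 5 →
    S (p ∸ 1) ≡ ((- (+ 77)) / 1200) * ((+ p) / 1) - ((+ 1) / 30) [modℚ p ^ 2 ]
corollary3p2 zero    p-prime ()
corollary3p2 (suc n) p-prime p>5 =
  subst (_∣ ℤ.∣ ↥ z ∣) p·p≡p²
    (numerator-divisible z p-prime (∤-86400 p-prime p>5) reduced-integral (shifted-sum-identity n))
  where
  z = S n - rhs (ℕ→ℚ (suc n))
  reduced-integral : Integral (suc n) (reduced (ℕ→ℚ (suc n)) (T (suc n) n))
  reduced-integral = Integral-horner₂ p-prime reducedCoeffs
    (Integral-ℤ p-prime (+ suc n)) (Integral-T p-prime n 0 (ℕP.+-identityʳ n))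
  p·p≡p² : suc n ℕ.* suc n ≡ suc n ^ 2
  p·p≡p² = cong (suc n ℕ.*_) (sym (ℕP.*-identityʳ (suc n)))
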